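{- Let $\alpha=3+2\sqrt{2}$, $\beta=3-2\sqrt{2}$, and for integers $n\ge 0$ define $T_n=\frac{\alpha^n-\beta^n}{4\sqrt{2}}$, $B_n=T_{n+1}-T_n$ and $C_n=2(T_{n+1}+T_n)$. Then for every integer $n\ge 1$, $$(T_{2n}-1)C_n=T_{2n+1}C_{n-1}=\frac{B_{3n}-B_{n+1}}{2}.$$ -}

module Defs where

open import Data.Nat using (ℕ; zero; suc)
open import Data.Integer using (ℤ; +_; -[1+_])
open import Data.Rational using (ℚ; _/_; 0ℚ; 1ℚ)
import Data.Rational as Q
open import Data.Product using (_×_; _,_)

-- The field ℚ(√2): a pair (x , y) represents x + y√2.
ℚ√2 : Set
ℚ√2 = ℚ × ℚ

infixl 6 _⊕_ _⊖_
infixl 7 _⊛_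

_⊕_ : ℚ√2 → ℚ√2 → ℚ√2
(a , b) ⊕ (c , d) = (a Q.+ c , b Q.+ d)

_⊖_ : ℚ√2 → ℚ√2 → ℚ√2
(a , b) ⊖ (c , d) = (a Q.- c , b Q.- d)

_⊛_ : ℚ√2 → ℚ√2 → ℚ√2
(a , b) ⊛ (c , d) = (a Q.* c Q.+ (+ 2 / 1) Q.* (b Q.* d) , a Q.* d Q.+ b Q.* c)

ι : ℚ → ℚ√2
ι q = (q , 0ℚ)

one : ℚ√2
one = ι 1ℚ

_^_ : ℚ√2 → ℕ → ℚ√2
x ^ zero = one
x ^ suc n = x ⊛ (x ^ n)

α : ℚ√2
α = (+ 3 / 1 , + 2 / 1)

β : ℚ√2
β = (+ 3 / 1 , -[1+ 1 ] / 1)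

-- 1 / (4√2) = √2 / 8
inv4√2 : ℚ√2
inv4√2 = (0ℚ , + 1 / 8)

T : ℕ → ℚ√2
T n = ((α ^ n) ⊖ (β ^ n)) ⊛ inv4√2

B : ℕ → ℚ√2
B n = T (suc n) ⊖ T n

C : ℕ → ℚ√2
C n = ι (+ 2 / 1) ⊛ (T (suc n) ⊕ T n)

half : ℚ√2
half = ι (+ 1 / 2)

{-# OPTIONS --safe #-}
-- Put u = α ^ m and v = β ^ m, where n = m + 1.  By Binet's formula every T, B and C in the
-- statement is a combination of the u ^ i ⊛ α ^ k and v ^ i ⊛ β ^ k.  Since α ⊛ β = one also
-- u ⊛ v = one, and multiplying the terms of lower degree by u ⊛ v turns both equalities into
-- polynomial identities in independent variables u and v, which the ring solver for ℚ checks
-- componentwise.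
module Submission where

open import Defs
open import Data.Nat using (ℕ; _≤_; _*_; _+_; _∸_; zero; suc)
open import Data.Nat.Properties using (+-suc)
open import Data.Nat.Tactic.RingSolver using (solve)
open import Data.Fin using (Fin; zero; suc; _↑ˡ_; _↑ʳ_)
import Data.List as List
open import Data.Vec using (Vec; []; _∷_; _++_; map)
open import Data.Product using (_×_; _,_; proj₁; proj₂)
open import Data.Integer using (+_)
open import Data.Rational using (ℚ; _/_)
open import Data.Rational.Solver using (module +-*-Solver)
open +-*-Solver using (Polynomial; con; var; _:+_; _:*_; _:-_; ⟦_⟧; ⟦_⟧↓; prove)
open import Relation.Binary.PropositionalEquality
  using (_≡_; refl; cong; cong₂; sym; trans; module ≡-Reasoning)

-- ⊕, ⊖, ⊛ and ^ of Defs mirrored on pairs of ℚ-polynomials in the components of n elements of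
-- ℚ√2.  The semantics ⟦ p ⟧₂ unfolds definitionally to the mirrored ℚ√2 expression, so prove₂
-- establishes identities in ℚ√2 stated with the operations of Defs.
record Polynomial₂ (n : ℕ) : Set where
  constructor _,_
  field
    ℚ-part √2-part : Polynomial (n + n)
open Polynomial₂

module _ {n : ℕ} where

  infixl 6 _:⊕_ _:⊖_
  infixl 7 _:⊛_
  infixr 8 _:^_

  _:⊕_ _:⊖_ _:⊛_ : Polynomial₂ n → Polynomial₂ n → Polynomial₂ n
  (a , b) :⊕ (c , d) = (a :+ c , b :+ d)
  (a , b) :⊖ (c , d) = (a :- c , b :- d)
  (a , b) :⊛ (c , d) = (a :* c :+ con (+ 2 / 1) :* (b :* d) , a :* d :+ b :* c)

  con₂ : ℚ√2 → Polynomial₂ n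
  con₂ (a , b) = (con a , con b)

  _:^_ : Polynomial₂ n → ℕ → Polynomial₂ n
  p :^ zero  = con₂ one
  p :^ suc k = p :⊛ p :^ k

  var₂ : Fin n → Polynomial₂ n
  var₂ i = (var (i ↑ˡ n) , var (n ↑ʳ i))

  components : Vec ℚ√2 n → Vec ℚ (n + n)
  components xs = map proj₁ xs ++ map proj₂ xs

  ⟦_⟧₂ : Polynomial₂ n → Vec ℚ√2 n → ℚ√2
  ⟦ (a , b) ⟧₂ xs = (⟦ a ⟧ (components xs) , ⟦ b ⟧ (components xs))

  prove₂ : (xs : Vec ℚ√2 n) (p q : Polynomial₂ n) →
           ⟦ ℚ-part p ⟧↓ (components xs) ≡ ⟦ ℚ-part q ⟧↓ (components xs) →
           ⟦ √2-part p ⟧↓ (components xs) ≡ ⟦ √2-part q ⟧↓ (components xs) →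
           ⟦ p ⟧₂ xs ≡ ⟦ q ⟧₂ xs
  prove₂ xs (a , b) (c , d) a≡c b≡d =
    cong₂ _,_ (prove (components xs) a c a≡c) (prove (components xs) b d b≡d)

⊛-identityˡ : ∀ x → one ⊛ x ≡ x
⊛-identityˡ x = prove₂ (x ∷ []) (con₂ one :⊛ X) X refl refl
  where X : Polynomial₂ 1
        X = var₂ zero

⊛-identityʳ : ∀ x → x ⊛ one ≡ x
⊛-identityʳ x = prove₂ (x ∷ []) (X :⊛ con₂ one) X refl refl
  where X : Polynomial₂ 1
        X = var₂ zero

⊛-assoc : ∀ x y z → (x ⊛ y) ⊛ z ≡ x ⊛ (y ⊛ z)
⊛-assoc x y z = prove₂ (x ∷ y ∷ z ∷ []) ((X :⊛ Y) :⊛ Z) (X :⊛ (Y :⊛ Z)) refl refl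
  where X Y Z : Polynomial₂ 3
        X = var₂ zero; Y = var₂ (suc zero); Z = var₂ (suc (suc zero))

^-distribˡ-+-⊛ : ∀ x i j → x ^ (i + j) ≡ x ^ i ⊛ x ^ j
^-distribˡ-+-⊛ x zero    j = sym (⊛-identityˡ (x ^ j))
^-distribˡ-+-⊛ x (suc i) j = begin
  x ⊛ x ^ (i + j)        ≡⟨ cong (x ⊛_) (^-distribˡ-+-⊛ x i j) ⟩
  x ⊛ (x ^ i ⊛ x ^ j)    ≡⟨ ⊛-assoc x (x ^ i) (x ^ j) ⟨
  x ⊛ x ^ i ⊛ x ^ j      ∎
  where open ≡-Reasoning

^-*-assoc : ∀ x m i → (x ^ m) ^ i ≡ x ^ (i * m)
^-*-assoc x m zero    = refl
^-*-assoc x m (suc i) =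
  trans (cong (x ^ m ⊛_) (^-*-assoc x m i)) (sym (^-distribˡ-+-⊛ x m (i * m)))

^-split : ∀ x m i k → x ^ (i * m + k) ≡ (x ^ m) ^ i ⊛ x ^ k
^-split x m i k = trans (^-distribˡ-+-⊛ x (i * m) k) (cong (_⊛ x ^ k) (sym (^-*-assoc x m i)))

αx⊛βy≡x⊛y : ∀ x y → (α ⊛ x) ⊛ (β ⊛ y) ≡ x ⊛ y
αx⊛βy≡x⊛y x y = prove₂ (x ∷ y ∷ []) ((con₂ α :⊛ X) :⊛ (con₂ β :⊛ Y)) (X :⊛ Y) refl refl
  where X Y : Polynomial₂ 2
        X = var₂ zero; Y = var₂ (suc zero)

α^⊛β^≡one : ∀ m → α ^ m ⊛ β ^ m ≡ one
α^⊛β^≡one zero    = refl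
α^⊛β^≡one (suc m) = trans (αx⊛βy≡x⊛y (α ^ m) (β ^ m)) (α^⊛β^≡one m)

binet : ℚ√2 → ℚ√2 → ℕ → ℕ → ℚ√2
binet u v i k = (u ^ i ⊛ α ^ k ⊖ v ^ i ⊛ β ^ k) ⊛ inv4√2

binetB binetC : ℚ√2 → ℚ√2 → ℕ → ℕ → ℚ√2
binetB u v i k = binet u v i (suc k) ⊖ binet u v i k
binetC u v i k = ι (+ 2 / 1) ⊛ (binet u v i (suc k) ⊕ binet u v i k)

private
  :binet :binetB :binetC : Polynomial₂ 2 → Polynomial₂ 2 → ℕ → ℕ → Polynomial₂ 2
  :binet U V i k = (U :^ i :⊛ con₂ (α ^ k) :⊖ V :^ i :⊛ con₂ (β ^ k)) :⊛ con₂ inv4√2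
  :binetB U V i k = :binet U V i (suc k) :⊖ :binet U V i k
  :binetC U V i k = con₂ (ι (+ 2 / 1)) :⊛ (:binet U V i (suc k) :⊕ :binet U V i k)

  U V : Polynomial₂ 2
  U = var₂ zero
  V = var₂ (suc zero)

binet-identity₁ : ∀ u v →
  (binet u v 2 2 ⊖ u ⊛ v) ⊛ binetC u v 1 1 ≡ binet u v 2 3 ⊛ binetC u v 1 0
binet-identity₁ u v = prove₂ (u ∷ v ∷ [])
  ((:binet U V 2 2 :⊖ U :⊛ V) :⊛ :binetC U V 1 1)
  (:binet U V 2 3 :⊛ :binetC U V 1 0) refl refl

binet-identity₂ : ∀ u v →
  binet u v 2 3 ⊛ binetC u v 1 0 ≡ (binetB u v 3 3 ⊖ binetB u v 1 2 ⊛ (u ⊛ v)) ⊛ half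
binet-identity₂ u v = prove₂ (u ∷ v ∷ [])
  (:binet U V 2 3 :⊛ :binetC U V 1 0)
  ((:binetB U V 3 3 :⊖ :binetB U V 1 2 :⊛ (U :⊛ V)) :⊛ con₂ half) refl refl

module _ (m : ℕ) where

  private
    u v : ℚ√2
    u = α ^ m
    v = β ^ m

  T-binet : ∀ {j} i k → j ≡ i * m + k → T j ≡ binet u v i k
  T-binet i k refl = cong₂ (λ a b → (a ⊖ b) ⊛ inv4√2) (^-split α m i k) (^-split β m i k)

  T-suc-binet : ∀ {j} i k → j ≡ i * m + k → T (suc j) ≡ binet u v i (suc k)
  T-suc-binet i k j≡ = T-binet i (suc k) (trans (cong suc j≡) (sym (+-suc (i * m) k)))

  B-binet : ∀ {j} i k → j ≡ i * m + k → B j ≡ binetB u v i k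
  B-binet i k j≡ = cong₂ _⊖_ (T-suc-binet i k j≡) (T-binet i k j≡)

  C-binet : ∀ {j} i k → j ≡ i * m + k → C j ≡ binetC u v i k
  C-binet i k j≡ = cong (ι (+ 2 / 1) ⊛_) (cong₂ _⊕_ (T-suc-binet i k j≡) (T-binet i k j≡))

  private
    m≡m+0     : m ≡ 1 * m + 0
    n≡m+1     : suc m ≡ 1 * m + 1
    n+1≡m+2   : suc m + 1 ≡ 1 * m + 2
    2n≡2m+2   : 2 * suc m ≡ 2 * m + 2
    2n+1≡2m+3 : 2 * suc m + 1 ≡ 2 * m + 3
    3n≡3m+3   : 3 * suc m ≡ 3 * m + 3
    m≡m+0     = solve (m List.∷ List.[])
    n≡m+1     = solve (m List.∷ List.[])
    n+1≡m+2   = solve (m List.∷ List.[])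
    2n≡2m+2   = solve (m List.∷ List.[])
    2n+1≡2m+3 = solve (m List.∷ List.[])
    3n≡3m+3   = solve (m List.∷ List.[])

  T₂ₙ-one·Cₙ-binet :
    (T (2 * suc m) ⊖ one) ⊛ C (suc m) ≡ (binet u v 2 2 ⊖ u ⊛ v) ⊛ binetC u v 1 1
  T₂ₙ-one·Cₙ-binet = trans
    (cong₂ (λ t c → (t ⊖ one) ⊛ c) (T-binet 2 2 2n≡2m+2) (C-binet 1 1 n≡m+1))
    (cong (λ w → (binet u v 2 2 ⊖ w) ⊛ binetC u v 1 1) (sym (α^⊛β^≡one m)))

  T₂ₙ₊₁·Cₙ₋₁-binet : T (2 * suc m + 1) ⊛ C m ≡ binet u v 2 3 ⊛ binetC u v 1 0
  T₂ₙ₊₁·Cₙ₋₁-binet = cong₂ _⊛_ (T-binet 2 3 2n+1≡2m+3) (C-binet 1 0 m≡m+0)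

  B₃ₙ-Bₙ₊₁-binet :
    (B (3 * suc m) ⊖ B (suc m + 1)) ⊛ half ≡ (binetB u v 3 3 ⊖ binetB u v 1 2 ⊛ (u ⊛ v)) ⊛ half
  B₃ₙ-Bₙ₊₁-binet = begin
    (B (3 * suc m) ⊖ B (suc m + 1)) ⊛ half
      ≡⟨ cong₂ (λ b b′ → (b ⊖ b′) ⊛ half) (B-binet 3 3 3n≡3m+3) (B-binet 1 2 n+1≡m+2) ⟩
    (binetB u v 3 3 ⊖ binetB u v 1 2) ⊛ half
      ≡⟨ cong (λ b → (binetB u v 3 3 ⊖ b) ⊛ half) (⊛-identityʳ (binetB u v 1 2)) ⟨
    (binetB u v 3 3 ⊖ binetB u v 1 2 ⊛ one) ⊛ half
      ≡⟨ cong (λ w → (binetB u v 3 3 ⊖ binetB u v 1 2 ⊛ w) ⊛ half) (α^⊛β^≡one m) ⟨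
    (binetB u v 3 3 ⊖ binetB u v 1 2 ⊛ (u ⊛ v)) ⊛ half ∎
    where open ≡-Reasoning

mainTheorem6 : (n : ℕ) → 1 ≤ n →
    ((T (2 * n) ⊖ one) ⊛ C n ≡ T (2 * n + 1) ⊛ C (n ∸ 1))
    × (T (2 * n + 1) ⊛ C (n ∸ 1) ≡ (B (3 * n) ⊖ B (n + 1)) ⊛ half)
mainTheorem6 (suc m) _ =
  trans (T₂ₙ-one·Cₙ-binet m) (trans (binet-identity₁ u v) (sym (T₂ₙ₊₁·Cₙ₋₁-binet m))) ,
  trans (T₂ₙ₊₁·Cₙ₋₁-binet m) (trans (binet-identity₂ u v) (sym (B₃ₙ-Bₙ₊₁-binet m)))
  where
  u v : ℚ√2
  u = α ^ m
  v = β ^ m
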